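{- Let $L$ be a levellised $n$-poset with $\mathrm{dep}_L(n-1)=k$, let $m$ be a positive integer, and let $A_i\subseteq L\setminus\{0\}$ for $i=n,\ldots,n+m-1$. The following are equivalent: (A) $\widetilde{L}=L_{A_n,\ldots,A_{n+m-1}}$ is a levellised $(n+m)$-poset with $\mathrm{dep}_{\widetilde{L}}(a)=\mathrm{dep}_L(a)\le k$ for $1\le a<n$ and $\mathrm{dep}_{\widetilde{L}}(n)=\cdots=\mathrm{dep}_{\widetilde{L}}(n+m-1)=k+1$; (B) $A_i\cap\mathrm{lev}_k(L)\neq\emptyset$ for all $n\le i<n+m$.
   Context: An $n$-poset ($n\ge2$) is a finite poset whose $n$ elements are labelled $0,1,\ldots,n-1$, where $0$ is the least element and $1$ is the greatest element. The depth $\mathrm{dep}_L(a)$ is the integer $p$ such that $p+1$ is the maximum number of elements of a chain in $L$ with least element $a$ and greatest element $1$. $\mathrm{lev}_k(L)=\{a\in L:\mathrm{dep}_L(a)=k\}$. An $n$-poset $L$ is levellised if $\mathrm{dep}_L(i)\le\mathrm{dep}_L(j)$ whenever $0<i\le j<n$. For an $n$-poset $L$ and $A\subseteq L\setminus\{0\}$, $L_A$ is the $(n+1)$-poset on $\{0,\ldots,n\}$ whose order is the reflexive-transitive closure of $\preceq_L$ together with $0\preceq n$ and $n\preceq a$ for all $a\in A$ (so $n$ is a new atom, and if $A$ is an antichain then the set of elements covering $n$ is exactly $A$). For $A_n,\ldots,A_{n+m-1}\subseteq L\setminus\{0\}$, $L_{A_n,\ldots,A_{n+m-1}}=(\cdots((L_{A_n})_{A_{n+1}})\cdots)_{A_{n+m-1}}$,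 the $(n+m)$-poset obtained by adding new atoms $n,\ldots,n+m-1$ where $i$ lies below exactly the elements of $L$ lying above some element of $A_i$. -}

module Defs where

open import Data.Nat using (ℕ; zero; suc; _+_; _∸_; _≤_; _<_)
open import Data.Product using (_×_; ∃-syntax)
open import Relation.Binary.PropositionalEquality using (_≡_; _≢_)

-- An order on the label set {0,…,n-1} is given by a relation on ℕ;
-- only its restriction to labels < n is ever consulted.
Rel : Set₁
Rel = ℕ → ℕ → Set

record IsNPoset (n : ℕ) (R : Rel) : Set where
  field
    two≤n   : 2 ≤ n
    reflex  : ∀ a → a < n → R a a
    antisym : ∀ a b → a < n → b < n → R a b → R b a → a ≡ b
    trans   : ∀ a b c → a < n → b < n → c < n → R a b → R b c → R a c
    least   : ∀ a → a < n → R 0 a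
    greatest : ∀ a → a < n → R a 1

data SChain (n : ℕ) (R : Rel) : ℕ → ℕ → ℕ → Set where
  done : ∀ {a} → a < n → SChain n R a a 0
  step : ∀ {a b c p} → a < n → R a b → a ≢ b → SChain n R b c p →
         SChain n R a c (suc p)

-- dep_L(a) = p : p+1 is the maximum number of elements of a chain
-- with least element a and greatest element 1.
IsDepth : (n : ℕ) → Rel → ℕ → ℕ → Set
IsDepth n R a p = SChain n R a 1 p × (∀ q → SChain n R a 1 q → q ≤ p)

InLev : (n : ℕ) → Rel → ℕ → ℕ → Set
InLev n R k a = a < n × IsDepth n R a k

Levellised : (n : ℕ) → Rel → Set
Levellised n R = ∀ i j → 0 < i → i ≤ j → j < n →
  ∀ p q → IsDepth n R i p → IsDepth n R j q → p ≤ q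

data Ext (n : ℕ) (R : Rel) (A : ℕ → Set) : Rel where
  base : ∀ {a b} → a < n → b < n → R a b → Ext n R A a b
  zero≼new : Ext n R A 0 n
  new≼ : ∀ {a} → A a → Ext n R A n a
  new-refl : Ext n R A n n
  trans : ∀ {a b c} → Ext n R A a b → Ext n R A b c → Ext n R A a c

-- L_{A_n,…,A_{n+j-1}} (an (n+j)-poset); A i a means a ∈ A_i.
Iter : (n : ℕ) → Rel → (ℕ → ℕ → Set) → ℕ → Rel
Iter n R A zero = R
Iter n R A (suc j) = Ext (n + j) (Iter n R A j) (A (n + j))

CondA : (n : ℕ) → Rel → (ℕ → ℕ → Set) → ℕ → ℕ → Set
CondA n R A m k =
  let L~ = Iter n R A m in
  IsNPoset (n + m) L~ × Levellised (n + m) L~ ×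
  (∀ a → 1 ≤ a → a < n → ∀ p → IsDepth n R a p → IsDepth (n + m) L~ a p × p ≤ k) ×
  (∀ i → n ≤ i → i < n + m → IsDepth (n + m) L~ i (suc k))

CondB : (n : ℕ) → Rel → (ℕ → ℕ → Set) → ℕ → ℕ → Set
CondB n R A m k = ∀ i → n ≤ i → i < n + m → ∃[ a ] (A i a × InLev n R k a)

-- The extension only adds atoms: a new atom i lies above 0 and below the up-set of A_i,
-- and nothing else changes. So chains starting at nonzero old elements are the chains of L,
-- and a longest chain from i to 1 is i ≺ a ≺ … ≺ 1 for some a ∈ A_i. Hence old depths are
-- preserved, and dep(i) = 1 + max{dep(a) : a ∈ A_i}. Since L is levellised, all depths in L
-- are at most k = dep(n-1), so dep(i) = k + 1 exactly when A_i meets lev_k(L).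
module Submission where

open import Defs
open import Data.Nat using (ℕ; zero; suc; _+_; _∸_; _≤_; _<_; z≤n; s≤s; _<?_; _≤?_; _≟_)
open import Data.Nat.Properties
open import Data.Fin using (Fin; toℕ; fromℕ<) renaming (zero to fzero; suc to fsuc)
open import Data.Fin.Properties using (pigeonhole; toℕ-fromℕ<)
open import Data.Product using (_×_; _,_; proj₂; ∃-syntax)
open import Data.Sum using (_⊎_; inj₁; inj₂)
open import Relation.Nullary using (¬_; yes; no; contradiction)
open import Relation.Nullary.Decidable using (decidable-stable)
open import Relation.Binary.PropositionalEquality using (_≡_; _≢_; refl; cong; subst; subst₂)
open import Function.Bundles using (_⇔_; mk⇔)

<⇒≤∸1 : ∀ {c n} → c < n → c ≤ n ∸ 1
<⇒≤∸1 {n = suc n} (s≤s c≤n) = c≤n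

∸1< : ∀ {n} → 0 < n → n ∸ 1 < n
∸1< {suc n} _ = n<1+n n

<⇒<+ : ∀ {x n} j → x < n → x < n + j
<⇒<+ {n = n} j x<n = <-≤-trans x<n (m≤m+n n j)

n+j<n+1+j : ∀ n j → n + j < n + suc j
n+j<n+1+j n j = +-monoʳ-< n (n<1+n j)

<+suc : ∀ {x} n j → x < n + j → x < n + suc j
<+suc n j x< = <-≤-trans x< (+-monoʳ-≤ n (n≤1+n j))

<+suc⇒≡⊎< : ∀ {x} n j → x < n + suc j → x ≡ n + j ⊎ x < n + j
<+suc⇒≡⊎< {x} n j x< with m<1+n⇒m<n∨m≡n (subst (x <_) (+-suc n j) x<)
... | inj₁ x<n+j = inj₂ x<n+j
... | inj₂ x≡n+j = inj₁ x≡n+j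

¬¬-maximum : (P : ℕ → Set) (b : ℕ) → (∀ q → P q → q < b) →
  ∀ {q} → P q → ¬ ¬ (∃[ p ] (P p × (∀ q → P q → q ≤ p)))
¬¬-maximum P zero    bounded Pq _     = n≮0 (bounded _ Pq)
¬¬-maximum P (suc b) bounded Pq noMax = ¬¬-maximum P b bounded′ Pq noMax
  where
  bounded′ : ∀ q → P q → q < b
  bounded′ q Pq′ with m<1+n⇒m<n∨m≡n (bounded q Pq′)
  ... | inj₁ q<b  = q<b
  ... | inj₂ refl = contradiction (q , Pq′ , λ r Pr → ≤-pred (bounded r Pr)) noMax

module _ {n : ℕ} {R : Rel} where

  SChain-head< : ∀ {a b p} → SChain n R a b p → a < n
  SChain-head< (done a<n)       = a<n
  SChain-head< (step a<n _ _ _) = a<n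

  IsDepth-unique : ∀ {a p q} → IsDepth n R a p → IsDepth n R a q → p ≡ q
  IsDepth-unique {p = p} {q} (chp , maxp) (chq , maxq) = ≤-antisym (maxq p chp) (maxp q chq)

module NPoset {n : ℕ} {R : Rel} (P : IsNPoset n R) where
  open IsNPoset P renaming (trans to ≼-trans)

  0<n : 0 < n
  0<n = <-trans (n<1+n 0) two≤n

  1<n : 1 < n
  1<n = two≤n

  positive⋠0 : ∀ {a} → a < n → 1 ≤ a → ¬ R a 0
  positive⋠0 {suc a} a<n _ a≼0 with antisym (suc a) 0 a<n 0<n a≼0 (least (suc a) a<n)
  ... | ()

  ≼-positive : ∀ {a c} → a < n → 1 ≤ a → R a c → 1 ≤ c
  ≼-positive {c = zero}  a<n 1≤a a≼0 = contradiction a≼0 (positive⋠0 a<n 1≤a)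
  ≼-positive {c = suc c} _   _   _   = s≤s z≤n

  element : ∀ {a b p} → SChain n R a b p → Fin (suc p) → ℕ
  element {a} _           fzero    = a
  element (step _ _ _ ch) (fsuc i) = element ch i

  element<n : ∀ {a b p} (ch : SChain n R a b p) i → element ch i < n
  element<n ch              fzero    = SChain-head< ch
  element<n (step _ _ _ ch) (fsuc i) = element<n ch i

  head≺element : ∀ {a b p} (ch : SChain n R a b p) (i : Fin p) →
    R a (element ch (fsuc i)) × a ≢ element ch (fsuc i)
  head≺element (step a<n a≼c a≢c ch) fzero = a≼c , a≢c
  head≺element {a} (step {b = c} a<n a≼c a≢c ch) (fsuc i) with head≺element ch i
  ... | c≼e , _ =
    ≼-trans a c _ a<n c<n e<n a≼c c≼e ,
    λ { refl → a≢c (antisym a c a<n c<n a≼c c≼e) }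
    where
    c<n = SChain-head< ch
    e<n = element<n ch (fsuc i)

  element-injective : ∀ {a b p} (ch : SChain n R a b p) (i j : Fin (suc p)) →
    toℕ i < toℕ j → element ch i ≢ element ch j
  element-injective ch              fzero    (fsuc j) _ = proj₂ (head≺element ch j)
  element-injective (step _ _ _ ch) (fsuc i) (fsuc j) i<j =
    element-injective ch i j (≤-pred i<j)

  SChain-length< : ∀ {a b p} → SChain n R a b p → p < n
  SChain-length< {p = p} ch with p <? n
  ... | yes p<n = p<n
  ... | no p≮n with pigeonhole (s≤s (≮⇒≥ p≮n)) (λ i → fromℕ< (element<n ch i))
  ...   | i , j , i<j , same = contradiction equal (element-injective ch i j i<j)
    where
    equal : element ch i ≡ element ch j
    equal = subst₂ _≡_ (toℕ-fromℕ< (element<n ch i)) (toℕ-fromℕ< (element<n ch j))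
                       (cong toℕ same)

  SChain-cons≼ : ∀ {a c b p} → a < n → R a c → SChain n R c b p →
    ∃[ q ] (SChain n R a b q × p ≤ q)
  SChain-cons≼ {a} {c} a<n a≼c ch with a ≟ c
  ... | yes refl = _ , ch , ≤-refl
  ... | no a≢c   = _ , step a<n a≼c a≢c ch , n≤1+n _

  -- R is an arbitrary relation, so the longest chain exists only up to double negation.
  ¬¬-IsDepth : ∀ {a q} → SChain n R a 1 q → ¬ ¬ (∃[ p ] IsDepth n R a p)
  ¬¬-IsDepth = ¬¬-maximum (SChain n R _ 1) n (λ _ → SChain-length<)

module LevellisedBound {n : ℕ} {R : Rel} (P : IsNPoset n R) (Lv : Levellised n R)
  {k : ℕ} (D : IsDepth n R (n ∸ 1) k) where
  open NPoset P

  depth≤k : ∀ {c p} → 1 ≤ c → c < n → IsDepth n R c p → p ≤ k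
  depth≤k {c} {p} 1≤c c<n Dc = Lv c (n ∸ 1) 1≤c (<⇒≤∸1 c<n) (∸1< 0<n) p k Dc D

  chain≤k : ∀ {c q} → 1 ≤ c → c < n → SChain n R c 1 q → q ≤ k
  chain≤k {q = q} 1≤c c<n ch = decidable-stable (q ≤? k) λ q≰k →
    ¬¬-IsDepth ch λ { (p , Dc) → q≰k (≤-trans (proj₂ Dc q ch) (depth≤k 1≤c c<n Dc)) }

module IteratedExtension {n : ℕ} {R : Rel} (P : IsNPoset n R) (A : ℕ → ℕ → Set) where
  open IsNPoset P renaming (trans to ≼-trans)
  open NPoset P

  Atoms⊆L : ℕ → Set
  Atoms⊆L j = ∀ i a → n ≤ i → i < n + j → A i a → 1 ≤ a × a < n

  data IterOrder (j : ℕ) : Rel where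
    old      : ∀ {x y} → x < n → y < n → R x y → IterOrder j x y
    bot≼new  : ∀ {y} → n ≤ y → y < n + j → IterOrder j 0 y
    new-refl : ∀ {x} → n ≤ x → x < n + j → IterOrder j x x
    new≼old  : ∀ {x y} a → n ≤ x → x < n + j → 1 ≤ a → a < n → A x a → R a y → y < n →
               IterOrder j x y

  IterOrder-weaken : ∀ {j x y} → IterOrder j x y → IterOrder (suc j) x y
  IterOrder-weaken         (old x<n y<n x≼y)    = old x<n y<n x≼y
  IterOrder-weaken {j}     (bot≼new n≤y y<)     = bot≼new n≤y (<+suc n j y<)
  IterOrder-weaken {j}     (new-refl n≤x x<)    = new-refl n≤x (<+suc n j x<)
  IterOrder-weaken {j} (new≼old a n≤x x< 1≤a a<n Aa a≼y y<n) =
    new≼old a n≤x (<+suc n j x<) 1≤a a<n Aa a≼y y<n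

  IterOrder-refl : ∀ {j x} → x < n + j → IterOrder j x x
  IterOrder-refl {x = x} x< with x <? n
  ... | yes x<n = old x<n x<n (reflex x x<n)
  ... | no x≮n  = new-refl (≮⇒≥ x≮n) x<

  IterOrder-least : ∀ {j x} → x < n + j → IterOrder j 0 x
  IterOrder-least {x = x} x< with x <? n
  ... | yes x<n = old 0<n x<n (least x x<n)
  ... | no x≮n  = bot≼new (≮⇒≥ x≮n) x<

  IterOrder-trans : ∀ {j x y z} → IterOrder j x y → IterOrder j y z → IterOrder j x z
  IterOrder-trans {x = x} {y} {z} (old x<n y<n x≼y) (old _ z<n y≼z) =
    old x<n z<n (≼-trans x y z x<n y<n z<n x≼y y≼z)
  IterOrder-trans (old x<n _ x≼0) (bot≼new n≤z z<)
    with refl ← antisym _ 0 x<n 0<n x≼0 (least _ x<n) = bot≼new n≤z z<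
  IterOrder-trans (old _ y<n _) (new-refl n≤y _) = contradiction n≤y (<⇒≱ y<n)
  IterOrder-trans (old _ y<n _) (new≼old _ n≤y _ _ _ _ _ _) = contradiction n≤y (<⇒≱ y<n)
  IterOrder-trans (bot≼new n≤y _) (old y<n _ _) = contradiction n≤y (<⇒≱ y<n)
  IterOrder-trans (bot≼new n≤0 _) (bot≼new _ _) = contradiction n≤0 (<⇒≱ 0<n)
  IterOrder-trans (bot≼new n≤y y<) (new-refl _ _) = bot≼new n≤y y<
  IterOrder-trans (bot≼new _ _) (new≼old {y = z} _ _ _ _ _ _ _ z<n) = old 0<n z<n (least z z<n)
  IterOrder-trans (new-refl _ _) y≼z = y≼z
  IterOrder-trans {y = y} {z} (new≼old a n≤x x< 1≤a a<n Aa a≼y y<n) (old _ z<n y≼z) =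
    new≼old a n≤x x< 1≤a a<n Aa (≼-trans a y z a<n y<n z<n a≼y y≼z) z<n
  IterOrder-trans (new≼old _ _ _ 1≤a a<n _ a≼0 _) (bot≼new _ _) =
    contradiction a≼0 (positive⋠0 a<n 1≤a)
  IterOrder-trans (new≼old _ _ _ _ _ _ _ y<n) (new-refl n≤y _) = contradiction n≤y (<⇒≱ y<n)
  IterOrder-trans (new≼old _ _ _ _ _ _ _ y<n) (new≼old _ n≤y _ _ _ _ _ _) =
    contradiction n≤y (<⇒≱ y<n)

  IterOrder-antisym : ∀ {j x y} → IterOrder j x y → IterOrder j y x → x ≡ y
  IterOrder-antisym (new-refl _ _) _ = refl
  IterOrder-antisym _ (new-refl _ _) = refl
  IterOrder-antisym {x = x} {y} (old x<n y<n x≼y) (old _ _ y≼x) = antisym x y x<n y<n x≼y y≼x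
  IterOrder-antisym (old x<n _ _) (bot≼new n≤x _) = contradiction n≤x (<⇒≱ x<n)
  IterOrder-antisym (old _ y<n _) (new≼old _ n≤y _ _ _ _ _ _) = contradiction n≤y (<⇒≱ y<n)
  IterOrder-antisym (bot≼new n≤y _) (old y<n _ _) = contradiction n≤y (<⇒≱ y<n)
  IterOrder-antisym (bot≼new _ _) (bot≼new _ _) = refl
  IterOrder-antisym (bot≼new _ _) (new≼old _ _ _ 1≤a a<n _ a≼0 _) =
    contradiction a≼0 (positive⋠0 a<n 1≤a)
  IterOrder-antisym (new≼old _ n≤x _ _ _ _ _ _) (old _ x<n _) = contradiction n≤x (<⇒≱ x<n)
  IterOrder-antisym (new≼old _ _ _ 1≤a a<n _ a≼0 _) (bot≼new _ _) =
    contradiction a≼0 (positive⋠0 a<n 1≤a)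
  IterOrder-antisym (new≼old _ _ _ _ _ _ _ y<n) (new≼old _ n≤y _ _ _ _ _ _) =
    contradiction n≤y (<⇒≱ y<n)

  mutual
    Iter⇒IterOrder : ∀ j → Atoms⊆L j → ∀ {x y} → x < n + j → y < n + j →
      Iter n R A j x y → IterOrder j x y
    Iter⇒IterOrder zero _ {x} {y} x< y< x≼y =
      old (subst (x <_) (+-identityʳ n) x<) (subst (y <_) (+-identityʳ n) y<) x≼y
    Iter⇒IterOrder (suc j) atoms _ _ x≼y = Ext⇒IterOrder j atoms x≼y

    Ext⇒IterOrder : ∀ j → Atoms⊆L (suc j) → ∀ {x y} →
      Ext (n + j) (Iter n R A j) (A (n + j)) x y → IterOrder (suc j) x y
    Ext⇒IterOrder j atoms (base x< y< x≼y) =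
      IterOrder-weaken (Iter⇒IterOrder j atoms′ x< y< x≼y)
      where
      atoms′ : Atoms⊆L j
      atoms′ i a n≤i i< = atoms i a n≤i (<+suc n j i<)
    Ext⇒IterOrder j atoms zero≼new = bot≼new (m≤m+n n j) (n+j<n+1+j n j)
    Ext⇒IterOrder j atoms (new≼ {a} Aa)
      with 1≤a , a<n ← atoms (n + j) a (m≤m+n n j) (n+j<n+1+j n j) Aa =
      new≼old a (m≤m+n n j) (n+j<n+1+j n j) 1≤a a<n Aa (reflex a a<n) a<n
    Ext⇒IterOrder j atoms new-refl = new-refl (m≤m+n n j) (n+j<n+1+j n j)
    Ext⇒IterOrder j atoms (trans x≼y y≼z) =
      IterOrder-trans (Ext⇒IterOrder j atoms x≼y) (Ext⇒IterOrder j atoms y≼z)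

  IterOrder⇒Iter : ∀ j {x y} → IterOrder j x y → Iter n R A j x y
  IterOrder⇒Iter zero (old _ _ x≼y) = x≼y
  IterOrder⇒Iter zero {y = y} (bot≼new n≤y y<) =
    contradiction n≤y (<⇒≱ (subst (y <_) (+-identityʳ n) y<))
  IterOrder⇒Iter zero {x} (new-refl n≤x x<) =
    contradiction n≤x (<⇒≱ (subst (x <_) (+-identityʳ n) x<))
  IterOrder⇒Iter zero {x} (new≼old _ n≤x x< _ _ _ _ _) =
    contradiction n≤x (<⇒≱ (subst (x <_) (+-identityʳ n) x<))
  IterOrder⇒Iter (suc j) (old x<n y<n x≼y) =
    base (<⇒<+ j x<n) (<⇒<+ j y<n)
      (IterOrder⇒Iter j (old x<n y<n x≼y))
  IterOrder⇒Iter (suc j) (bot≼new n≤y y<) with <+suc⇒≡⊎< n j y<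
  ... | inj₁ refl = zero≼new
  ... | inj₂ y<′  = base (<⇒<+ j 0<n) y<′ (IterOrder⇒Iter j (bot≼new n≤y y<′))
  IterOrder⇒Iter (suc j) (new-refl n≤x x<) with <+suc⇒≡⊎< n j x<
  ... | inj₁ refl = new-refl
  ... | inj₂ x<′  = base x<′ x<′ (IterOrder⇒Iter j (new-refl n≤x x<′))
  IterOrder⇒Iter (suc j) (new≼old a n≤x x< 1≤a a<n Aa a≼y y<n) with <+suc⇒≡⊎< n j x<
  ... | inj₁ refl =
    trans (new≼ Aa) (base (<⇒<+ j a<n) (<⇒<+ j y<n)
      (IterOrder⇒Iter j (old a<n y<n a≼y)))
  ... | inj₂ x<′ =
    base x<′ (<⇒<+ j y<n) (IterOrder⇒Iter j (new≼old a n≤x x<′ 1≤a a<n Aa a≼y y<n))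

module Extended {n : ℕ} {R : Rel} (P : IsNPoset n R) (A : ℕ → ℕ → Set) (m : ℕ)
  (atoms : IteratedExtension.Atoms⊆L P A m) where
  open IsNPoset P
  open NPoset P
  open IteratedExtension P A

  N : ℕ
  N = n + m

  T : Rel
  T = Iter n R A m

  T-view : ∀ {x y} → x < N → y < N → T x y → IterOrder m x y
  T-view = Iter⇒IterOrder m atoms

  T-isNPoset : (∀ i → n ≤ i → i < N → ∃[ a ] A i a) → IsNPoset N T
  T-isNPoset nonempty = record
    { two≤n    = ≤-trans two≤n (m≤m+n n m)
    ; reflex   = λ x x< → IterOrder⇒Iter m (IterOrder-refl x<)
    ; antisym  = λ x y x< y< x≼y y≼x → IterOrder-antisym (T-view x< y< x≼y) (T-view y< x< y≼x)
    ; trans    = λ x y z x< y< z< x≼y y≼z →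
                   IterOrder⇒Iter m (IterOrder-trans (T-view x< y< x≼y) (T-view y< z< y≼z))
    ; least    = λ x x< → IterOrder⇒Iter m (IterOrder-least x<)
    ; greatest = λ x x< → IterOrder⇒Iter m (IterOrder-greatest x<)
    }
    where
    IterOrder-greatest : ∀ {x} → x < N → IterOrder m x 1
    IterOrder-greatest {x} x< with x <? n
    ... | yes x<n = old x<n 1<n (greatest x x<n)
    ... | no x≮n with a , Aa ← nonempty x (≮⇒≥ x≮n) x<
                 with 1≤a , a<n ← atoms x a (≮⇒≥ x≮n) x< Aa =
      new≼old a (≮⇒≥ x≮n) x< 1≤a a<n Aa (greatest a a<n) 1<n

  SChain-lift : ∀ {a b p} → SChain n R a b p → SChain N T a b p
  SChain-lift (done a<n) = done (<⇒<+ m a<n)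
  SChain-lift (step a<n a≼c a≢c ch) =
    step (<⇒<+ m a<n) (IterOrder⇒Iter m (old a<n (SChain-head< ch) a≼c)) a≢c
      (SChain-lift ch)

  -- The only old element below a new atom is 0, so the extension adds nothing above a nonzero old element.
  SChain-lower : ∀ {a b p} → 1 ≤ a → a < n → SChain N T a b p → SChain n R a b p
  SChain-lower _ a<n (done _) = done a<n
  SChain-lower 1≤a a<n (step a< a≼c a≢c ch) with T-view a< (SChain-head< ch) a≼c
  ... | old _ c<n a≼′c = step a<n a≼′c a≢c (SChain-lower (≼-positive a<n 1≤a a≼′c) c<n ch)
  ... | bot≼new _ _ = contradiction 1≤a λ ()
  ... | new-refl n≤a _ = contradiction n≤a (<⇒≱ a<n)
  ... | new≼old _ n≤a _ _ _ _ _ _ = contradiction n≤a (<⇒≱ a<n)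

  IsDepth-lift : ∀ {a p} → 1 ≤ a → a < n → IsDepth n R a p → IsDepth N T a p
  IsDepth-lift 1≤a a<n (ch , max) = SChain-lift ch , λ q ch′ → max q (SChain-lower 1≤a a<n ch′)

  IsDepth-lower : ∀ {a p} → 1 ≤ a → a < n → IsDepth N T a p → IsDepth n R a p
  IsDepth-lower 1≤a a<n (ch , max) = SChain-lower 1≤a a<n ch , λ q ch′ → max q (SChain-lift ch′)

  new-chain-extend : ∀ {i a q} → n ≤ i → i < N → A i a → SChain n R a 1 q →
    SChain N T i 1 (suc q)
  new-chain-extend {i} {a} n≤i i< Aa ch with 1≤a , a<n ← atoms i a n≤i i< Aa =
    step i< (IterOrder⇒Iter m (new≼old a n≤i i< 1≤a a<n Aa (reflex a a<n) a<n))
      (λ { refl → <⇒≱ a<n n≤i }) (SChain-lift ch)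

  new-chain-restrict : ∀ {i q} → n ≤ i → i < N → SChain N T i 1 q →
    ∃[ a ] (A i a × ∃[ q′ ] (SChain n R a 1 q′ × q ≤ suc q′))
  new-chain-restrict n≤1 _ (done _) = contradiction n≤1 (<⇒≱ 1<n)
  new-chain-restrict n≤i i< (step _ i≼c i≢c ch) with T-view i< (SChain-head< ch) i≼c
  ... | old i<n _ _ = contradiction n≤i (<⇒≱ i<n)
  ... | bot≼new _ _ = contradiction n≤i (<⇒≱ 0<n)
  ... | new-refl _ _ = contradiction refl i≢c
  ... | new≼old a _ _ 1≤a a<n Aa a≼c c<n =
    let chC = SChain-lower (≼-positive a<n 1≤a a≼c) c<n ch
        q′ , chA , p≤q′ = SChain-cons≼ a<n a≼c chC
    in a , Aa , q′ , chA , s≤s p≤q′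

  lev-from-new-depth : ∀ {i k} → n ≤ i → i < N → IsDepth N T i (suc k) →
    ∃[ a ] (A i a × InLev n R k a)
  lev-from-new-depth {i} {k} n≤i i< (ch , max) with new-chain-restrict n≤i i< ch
  ... | a , Aa , q , chA , k<q+1 =
    a , Aa , proj₂ (atoms i a n≤i i< Aa) , subst (SChain n R a 1) q≡k chA , bound
    where
    bound : ∀ r → SChain n R a 1 r → r ≤ k
    bound r ch′ = ≤-pred (max (suc r) (new-chain-extend n≤i i< Aa ch′))
    q≡k : q ≡ k
    q≡k = ≤-antisym (bound q chA) (≤-pred k<q+1)

  module _ (Lv : Levellised n R) {k : ℕ} (D : IsDepth n R (n ∸ 1) k) where
    open LevellisedBound P Lv D

    new-depth : ∀ {i a} → n ≤ i → i < N → A i a → InLev n R k a → IsDepth N T i (suc k)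
    new-depth n≤i i< Aa (_ , chA , _) = new-chain-extend n≤i i< Aa chA , bound
      where
      bound : ∀ q → SChain N T _ 1 q → q ≤ suc k
      bound q ch with a′ , Aa′ , q′ , ch′ , q≤ ← new-chain-restrict n≤i i< ch
                 with 1≤a′ , a′<n ← atoms _ a′ n≤i i< Aa′ =
        ≤-trans q≤ (s≤s (chain≤k 1≤a′ a′<n ch′))

    T-levellised : (∀ i → n ≤ i → i < N → IsDepth N T i (suc k)) → Levellised N T
    T-levellised newDepth i j 1≤i i≤j j< p q Dᵢ Dⱼ with j <? n
    ... | yes j<n =
      let i<n = ≤-<-trans i≤j j<n in
      Lv i j 1≤i i≤j j<n p q
        (IsDepth-lower 1≤i i<n Dᵢ) (IsDepth-lower (≤-trans 1≤i i≤j) j<n Dⱼ)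
    ... | no j≮n with refl ← IsDepth-unique Dⱼ (newDepth j (≮⇒≥ j≮n) j<) with i <? n
    ...   | yes i<n = m≤n⇒m≤1+n (depth≤k 1≤i i<n (IsDepth-lower 1≤i i<n Dᵢ))
    ...   | no i≮n  = ≤-reflexive (IsDepth-unique Dᵢ (newDepth i (≮⇒≥ i≮n) (≤-<-trans i≤j j<)))

    B⇒A : CondB n R A m k → CondA n R A m k
    B⇒A condB =
      T-isNPoset (λ i n≤i i< → let a , Aa , _ = condB i n≤i i< in a , Aa) ,
      T-levellised newDepth ,
      (λ a 1≤a a<n p Dₐ → IsDepth-lift 1≤a a<n Dₐ , depth≤k 1≤a a<n Dₐ) ,
      newDepth
      where
      newDepth : ∀ i → n ≤ i → i < N → IsDepth N T i (suc k)
      newDepth i n≤i i< = let _ , Aa , a∈levₖ = condB i n≤i i< in new-depth n≤i i< Aa a∈levₖ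

  A⇒B : ∀ {k} → CondA n R A m k → CondB n R A m k
  A⇒B (_ , _ , _ , newDepth) i n≤i i< = lev-from-new-depth n≤i i< (newDepth i n≤i i<)

lemma3p11 : (n : ℕ) (R : Rel) → IsNPoset n R → Levellised n R →
    (k : ℕ) → IsDepth n R (n ∸ 1) k →
    (m : ℕ) → 1 ≤ m →
    (A : ℕ → ℕ → Set) →
    (∀ i a → n ≤ i → i < n + m → A i a → 1 ≤ a × a < n) →
    CondA n R A m k ⇔ CondB n R A m k
lemma3p11 n R P Lv k D m _ A atoms = mk⇔ A⇒B (B⇒A Lv D)
  where open Extended P A m atoms
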